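{- Let $n\ge1$. The periodic points of $s_{132}:S_n\to S_n$ are precisely the permutations in $S_n$ avoiding $132$ and $231$ classically, and the periodic points of $s_{312}:S_n\to S_n$ are precisely the permutations in $S_n$ avoiding $213$ and $312$ classically. When $n\ge2$, each of these periodic points has period $2$. Furthermore, for every $\pi\in S_n$, $s_{132}^{n-1}(\pi)$ avoids $132$ and $231$, and $s_{312}^{n-1}(\pi)$ avoids $213$ and $312$.
   Context: $S_n$ is the set of permutations of $[n]$ in one-line notation. Two sequences of distinct integers have the same relative order if replacing the $i$th smallest entry of each by $i$ yields the same word; a sequence contains $\sigma$ classically if some (not necessarily consecutive) subsequence has the same relative order as $\sigma$, and avoids it otherwise. For $\sigma\in\{132,312\}$, $s_\sigma:S_n\to S_n$ sends a permutation through a stack: at each step, if there is a next input entry and placing it on top of the stack would make the stack contents, read top to bottom, avoid $\sigma$ classically, push it; otherwise pop the top entry of the stack to the end of the output; stop when the output has length $n$. A periodic point of $f:S_n\to S_n$ is $\pi$ with $f^t(\pi)=\pi$ for some $t\ge1$; its period is the least such $t$; $f^0$ is the identity. -}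

module Defs where

open import Data.Nat using (ℕ; zero; suc; _+_; _*_; _<?_; _≟_)
open import Data.List using (List; []; _∷_; length; filter; map; upTo; _++_)
open import Data.List.Properties using (≡-dec)
open import Data.List.Relation.Binary.Sublist.Propositional using (_⊆_; []; _∷_; _∷ʳ_)
open import Data.List.Relation.Binary.Permutation.Propositional using (_↭_)
open import Data.List.Membership.Propositional using (_∈_; find)
open import Data.List.Relation.Unary.Any as Any using (Any; here; there; any?)
open import Data.List.Membership.Propositional.Properties using (∈-++⁺ˡ; ∈-++⁺ʳ; ∈-map⁺; ∈-++⁻; ∈-map⁻)
open import Data.Product using (Σ; ∃; _×_; _,_; proj₁; proj₂)
open import Data.Sum using (inj₁; inj₂)
open import Relation.Nullary using (Dec; yes; no; ¬_)
open import Relation.Binary.PropositionalEquality using (_≡_; refl; cong)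

IsPerm : ℕ → List ℕ → Set
IsPerm n π = π ↭ map suc (upTo n)

-- standardization: replace each entry by the number of entries smaller than it
-- (for distinct entries this replaces the i-th smallest by i-1)
rank : List ℕ → ℕ → ℕ
rank xs x = length (filter (_<? x) xs)

std : List ℕ → List ℕ
std xs = map (rank xs) xs

SameOrder : List ℕ → List ℕ → Set
SameOrder xs ys = std xs ≡ std ys

Contains : List ℕ → List ℕ → Set
Contains σ w = Σ (List ℕ) λ ys → ys ⊆ w × SameOrder ys σ

Avoids : List ℕ → List ℕ → Set
Avoids σ w = ¬ Contains σ w

sublists : List ℕ → List (List ℕ)
sublists [] = [] ∷ []
sublists (x ∷ xs) = sublists xs ++ map (x ∷_) (sublists xs)

⊆⇒∈ : ∀ {ys xs} → ys ⊆ xs → ys ∈ sublists xs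
⊆⇒∈ [] = here refl
⊆⇒∈ (y ∷ʳ p) = ∈-++⁺ˡ (⊆⇒∈ p)
⊆⇒∈ {xs = x ∷ xs} (refl ∷ p) = ∈-++⁺ʳ (sublists xs) (∈-map⁺ (x ∷_) (⊆⇒∈ p))

∈⇒⊆ : ∀ {ys} xs → ys ∈ sublists xs → ys ⊆ xs
∈⇒⊆ [] (here refl) = []
∈⇒⊆ (x ∷ xs) m with ∈-++⁻ (sublists xs) m
... | inj₁ m' = x ∷ʳ ∈⇒⊆ xs m'
... | inj₂ m' with ∈-map⁻ (x ∷_) m'
...   | zs , m'' , refl = refl ∷ ∈⇒⊆ xs m''

contains? : ∀ σ w → Dec (Contains σ w)
contains? σ w with any? (λ ys → ≡-dec _≟_ (std ys) (std σ)) (sublists w)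
... | yes a with find a
... | ys , m , e = yes (ys , ∈⇒⊆ w m , e)
contains? σ w | no na = no λ { (ys , p , e) → na (Any.map (λ { refl → e }) (⊆⇒∈ p)) }

-- Push the next input entry if the stack (top to bottom) would still avoid σ,
-- otherwise pop the top entry to the output; stop when input and stack are empty
-- (i.e. when the output has length n). 2n steps always suffice (n pushes, n pops).
go : List ℕ → ℕ → List ℕ → List ℕ → List ℕ
go σ zero inp st = []
go σ (suc f) [] [] = []
go σ (suc f) [] (y ∷ st) = y ∷ go σ f [] st
go σ (suc f) (x ∷ inp) st with contains? σ (x ∷ st)
go σ (suc f) (x ∷ inp) st | no _ = go σ f inp (x ∷ st)
go σ (suc f) (x ∷ inp) (y ∷ st) | yes _ = y ∷ go σ f (x ∷ inp) st
go σ (suc f) (x ∷ inp) [] | yes _ = go σ f inp (x ∷ [])  -- unreachable: a singleton avoids σ when |σ| ≥ 2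

stackSort : List ℕ → List ℕ → List ℕ
stackSort σ π = go σ (2 * length π) π []

s132 : List ℕ → List ℕ
s132 = stackSort (1 ∷ 3 ∷ 2 ∷ [])

s312 : List ℕ → List ℕ
s312 = stackSort (3 ∷ 1 ∷ 2 ∷ [])

iter : (List ℕ → List ℕ) → ℕ → List ℕ → List ℕ
iter f zero π = π
iter f (suc t) π = f (iter f t π)

IsPeriodic : (List ℕ → List ℕ) → List ℕ → Set
IsPeriodic f π = Σ ℕ λ t → (1 Data.Nat.≤ t) × iter f t π ≡ π

HasPeriod : (List ℕ → List ℕ) → List ℕ → ℕ → Set
HasPeriod f π t = (1 Data.Nat.≤ t) × iter f t π ≡ π
                × (∀ u → 1 Data.Nat.≤ u → u Data.Nat.< t → ¬ (iter f u π ≡ π))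

-- Everything is done relative to a strict total order ≺ on the entries: the usual order for
-- s₁₃₂, and the reversed order for s₃₁₂, under which 312 and 213 become 132 and 231.
--
-- A permutation avoids 132 and 231 iff it has no peak a ≺ b ≻ c, i.e. it descends and then
-- ascends. Reading such a word never forces a pop, so the stack map reverses it, and the reverse
-- is again peak-free: these words are periodic of period 2 (reverse π ≠ π as soon as n ≥ 2).
--
-- For the converse, the stack map commutes with deleting the largest entry n: it sends C n D
-- to E n F, where it sends C D to E F. After any pass E and F interleave: one of them is empty
-- or some entry of F lies below some entry of E. If moreover C D is peak-free and C, D
-- interleave, then n lands at an end of E n F, whose rest E F is the reverse of C D, so E n F
-- is peak-free. By induction on n, the word without n is peak-free after n − 2 passes, hence
-- s^(n−1) π is peak-free; so is every periodic point, as it lies on the orbit of s^(n−1) π.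

module Submission where

open import Defs
open import Data.Empty using (⊥; ⊥-elim)
open import Data.Unit using (⊤; tt)
open import Data.Nat using (ℕ; zero; suc; _+_; _*_; _∸_; _≤_; _<_; z≤n; s≤s; _<?_)
open import Data.Nat.Properties
  using (≤-trans; ≤-reflexive; +-suc; +-identityʳ; *-comm; suc-injective;
         <-irrefl; <-asym; <-trans; <-isStrictTotalOrder)
open import Data.Product using (Σ; ∃; ∃₂; _×_; _,_; proj₁)
import Data.Product as Product
open import Data.Sum using (_⊎_; inj₁; inj₂)
open import Data.List using (List; []; _∷_; _++_; [_]; _ʳ++_; length; reverse; upTo)
open import Data.List.Properties
  using (++-assoc; ++-identityʳ; unfold-reverse; reverse-involutive; ∷-injective; ∷-injectiveʳ;
         length-map; length-upTo; filter-accept; filter-reject)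
open import Data.List.Membership.Propositional using (_∈_; _∉_; find; lose)
open import Data.List.Relation.Unary.Any using (Any; here; there; any?)
import Data.List.Relation.Unary.Any as Any
import Data.List.Relation.Unary.Any.Properties as Anyₚ
open import Data.List.Relation.Unary.All using (All; []; _∷_; lookup; tabulate)
import Data.List.Relation.Unary.All as All
import Data.List.Relation.Unary.All.Properties as Allₚ
open import Data.List.Relation.Unary.Unique.Propositional using (Unique; []; _∷_)
import Data.List.Relation.Unary.Unique.Propositional.Properties as Uniqueₚ
open import Data.List.Relation.Binary.Permutation.Propositional
  using (_↭_; ↭-refl; ↭-trans; ↭-sym; ↭-prep; ↭⇒↭ₛ)
open import Data.List.Relation.Binary.Permutation.Propositional.Properties
  using (shift; ∈-resp-↭; All-resp-↭; ↭-length)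
import Data.List.Relation.Binary.Permutation.Setoid.Properties as Permutationₛ
open import Data.List.Relation.Binary.Sublist.Propositional
  using (_⊆_; []; _∷_; _∷ʳ_; ⊆-refl; ⊆-trans; minimum; from∈)
import Data.List.Relation.Binary.Sublist.Propositional.Properties as Sublist
open import Function using (_∘_; id)
open import Function.Bundles using (_⇔_; mk⇔; Equivalence)
open import Relation.Nullary using (Dec; yes; no; ¬_)
open import Relation.Nullary.Decidable using (_×-dec_; _⊎-dec_)
open import Relation.Binary using (IsStrictTotalOrder; tri<; tri≈; tri>)
import Relation.Binary.Construct.Flip.EqAndOrd as Flip
open import Relation.Binary.PropositionalEquality
  using (_≡_; _≢_; refl; sym; trans; cong; subst; subst₂; module ≡-Reasoning)
open import Relation.Binary.PropositionalEquality.Properties using (setoid)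

private variable
  A : Set

-- Entries occurring in a given order

Pair : (A → A → Set) → List A → Set
Pair Q []      = ⊥
Pair Q (b ∷ w) = Any (Q b) w ⊎ Pair Q w

Triple : (A → A → A → Set) → List A → Set
Triple P []      = ⊥
Triple P (a ∷ w) = Pair (P a) w ⊎ Triple P w

module _ {Q : A → A → Set} where

  pair? : (∀ b c → Dec (Q b c)) → ∀ w → Dec (Pair Q w)
  pair? Q? []      = no λ ()
  pair? Q? (b ∷ w) = any? (Q? b) w ⊎-dec pair? Q? w

  Pair⇒⊆ : ∀ {w} → Pair Q w → ∃₂ λ b c → b ∷ c ∷ [] ⊆ w × Q b c
  Pair⇒⊆ {w = b ∷ w} (inj₁ q) with find q
  ... | c , c∈w , qbc = b , c , refl ∷ from∈ c∈w , qbc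
  Pair⇒⊆ {w = y ∷ w} (inj₂ p) with Pair⇒⊆ p
  ... | b , c , bc⊆w , qbc = b , c , y ∷ʳ bc⊆w , qbc

  ⊆⇒Pair : ∀ {b c w} → b ∷ c ∷ [] ⊆ w → Q b c → Pair Q w
  ⊆⇒Pair (y ∷ʳ bc⊆w) q   = inj₂ (⊆⇒Pair bc⊆w q)
  ⊆⇒Pair (refl ∷ c⊆w) q = inj₁ (Sublist.Any-resp-⊆ c⊆w (here q))

  Pair⇒∈ : ∀ {w} → Pair Q w → ∃₂ λ b c → b ∈ w × c ∈ w × Q b c
  Pair⇒∈ p with Pair⇒⊆ p
  ... | b , c , bc⊆w , q =
    b , c , Sublist.Any-resp-⊆ bc⊆w (here refl) , Sublist.Any-resp-⊆ bc⊆w (there (here refl)) , q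

  Pair-resp-⊆ : ∀ {v w} → v ⊆ w → Pair Q v → Pair Q w
  Pair-resp-⊆ v⊆w p with Pair⇒⊆ p
  ... | _ , _ , bc⊆v , q = ⊆⇒Pair (⊆-trans bc⊆v v⊆w) q

  Pair-++⁻ : ∀ xs {ys} → Pair Q (xs ++ ys) →
             Pair Q xs ⊎ ∃₂ λ b c → b ∈ xs ++ ys × c ∈ ys × Q b c
  Pair-++⁻ []       p = inj₂ (Pair⇒∈ p)
  Pair-++⁻ (x ∷ xs) (inj₁ q) with Anyₚ.++⁻ xs q
  ... | inj₁ q′ = inj₁ (inj₁ q′)
  ... | inj₂ q′ with find q′
  ...   | c , c∈ys , qxc = inj₂ (x , c , here refl , c∈ys , qxc)
  Pair-++⁻ (x ∷ xs) (inj₂ p) with Pair-++⁻ xs p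
  ... | inj₁ p′ = inj₁ (inj₂ p′)
  ... | inj₂ (b , c , b∈ , c∈ys , q) = inj₂ (b , c , there b∈ , c∈ys , q)

module _ {P : A → A → A → Set} where

  Triple⇒⊆ : ∀ {w} → Triple P w → ∃₂ λ a b → ∃ λ c → a ∷ b ∷ c ∷ [] ⊆ w × P a b c
  Triple⇒⊆ {w = a ∷ w} (inj₁ p) with Pair⇒⊆ p
  ... | b , c , bc⊆w , q = a , b , c , refl ∷ bc⊆w , q
  Triple⇒⊆ {w = y ∷ w} (inj₂ t) with Triple⇒⊆ t
  ... | a , b , c , abc⊆w , q = a , b , c , y ∷ʳ abc⊆w , q

  ⊆⇒Triple : ∀ {a b c w} → a ∷ b ∷ c ∷ [] ⊆ w → P a b c → Triple P w
  ⊆⇒Triple (y ∷ʳ abc⊆w) q  = inj₂ (⊆⇒Triple abc⊆w q)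
  ⊆⇒Triple (refl ∷ bc⊆w) q = inj₁ (⊆⇒Pair bc⊆w q)

  Triple-resp-⊆ : ∀ {v w} → v ⊆ w → Triple P v → Triple P w
  Triple-resp-⊆ v⊆w t with Triple⇒⊆ t
  ... | _ , _ , _ , abc⊆v , q = ⊆⇒Triple (⊆-trans abc⊆v v⊆w) q

  Triple-length : ∀ {w} → Triple P w → 3 ≤ length w
  Triple-length t with Triple⇒⊆ t
  ... | _ , _ , _ , abc⊆w , _ = Sublist.length-mono-≤ abc⊆w

Triple-map : ∀ {P R : A → A → A → Set} {w} → (∀ {a b c} → P a b c → R a b c) →
             Triple P w → Triple R w
Triple-map f t with Triple⇒⊆ t
... | _ , _ , _ , abc⊆w , q = ⊆⇒Triple abc⊆w (f q)

Triple-reverse : ∀ {P : A → A → A → Set} {w} →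
                 Triple P w → Triple (λ c b a → P a b c) (reverse w)
Triple-reverse t with Triple⇒⊆ t
... | _ , _ , _ , abc⊆w , q = ⊆⇒Triple (Sublist.reverse⁺ abc⊆w) q

Unique-resp-⊇ : ∀ {xs ys : List A} → xs ⊆ ys → Unique ys → Unique xs
Unique-resp-⊇ []             []        = []
Unique-resp-⊇ (y ∷ʳ xs⊆ys)   (_ ∷ u)   = Unique-resp-⊇ xs⊆ys u
Unique-resp-⊇ (refl ∷ xs⊆ys) (x∉ ∷ u) =
  Sublist.All-resp-⊆ xs⊆ys x∉ ∷ Unique-resp-⊇ xs⊆ys u

Unique-resp-↭ : ∀ {xs ys : List A} → xs ↭ ys → Unique xs → Unique ys
Unique-resp-↭ xs↭ys = Permutationₛ.Unique-resp-↭ (setoid _) (↭⇒↭ₛ xs↭ys)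

Unique-++⇒∉ : ∀ (xs : List A) {ys} → Unique (xs ++ ys) → All (_∉ xs) ys
Unique-++⇒∉ []       _          = tabulate λ _ ()
Unique-++⇒∉ (x ∷ xs) (x∉ ∷ u) = tabulate λ y∈ys →
  λ { (here refl) → lookup x∉ (Anyₚ.++⁺ʳ xs y∈ys) refl
    ; (there y∈xs) → lookup (Unique-++⇒∉ xs u) y∈ys y∈xs }

Unique-remove : ∀ (xs : List A) {x ys} → Unique (xs ++ x ∷ ys) → Unique (xs ++ ys)
Unique-remove xs {x} {ys} u with Unique-resp-↭ (shift x xs ys) u
... | _ ∷ u′ = u′

reverse-≢ : ∀ {π : List A} → Unique π → 2 ≤ length π → reverse π ≢ π
reverse-≢ {π = a ∷ b ∷ w} (a∉ ∷ _) _ rev≡ with reverse (b ∷ w) | unfold-reverse a (b ∷ w)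
... | []     | eq with () ← ∷-injectiveʳ (trans (sym eq) rev≡)
... | r ∷ rs | eq =
  lookup a∉ (subst (a ∈_) (∷-injectiveʳ (trans (sym eq) rev≡)) (Anyₚ.++⁺ʳ rs (here refl))) refl
reverse-≢ {π = _ ∷ []} _ (s≤s ())

module StackSorting {A : Set} {_≺_ : A → A → Set}
                    (≺-isStrictTotalOrder : IsStrictTotalOrder _≡_ _≺_) where

  open IsStrictTotalOrder ≺-isStrictTotalOrder
    using (compare) renaming (_<?_ to _≺?_; trans to ≺-trans; asym to ≺-asym; irrefl to ≺-irrefl)

  private variable
    n t x y : A
    i st o C D E F P S T : List A

  _≼_ : A → A → Set
  a ≼ b = a ≺ b ⊎ a ≡ b

  Is132 Is231 IsPeak : A → A → A → Set
  Is132 a b c = a ≺ c × c ≺ b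
  Is231 a b c = c ≺ a × a ≺ b
  IsPeak a b c = a ≺ b × c ≺ b

  PeakFree : List A → Set
  PeakFree w = ¬ Triple IsPeak w

  -- When st (read top to bottom) avoids 132, x ∷ st contains 132 iff Blocked x st.
  Blocked : A → List A → Set
  Blocked x st = Pair (Is132 x) st

  blocked? : ∀ x st → Dec (Blocked x st)
  blocked? x st = pair? (λ b c → x ≺? c ×-dec c ≺? b) st

  data Run : List A → List A → List A → Set where
    done  : Run [] [] []
    flush : Run [] st o → Run [] (y ∷ st) (y ∷ o)
    push  : ¬ Blocked x st → Run i (x ∷ st) o → Run (x ∷ i) st o
    pop   : Blocked x (y ∷ st) → Run (x ∷ i) st o → Run (x ∷ i) (y ∷ st) (y ∷ o)

  -- The run stopped as soon as the input C is used up, having output P and left the stack S.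
  data Reads : List A → List A → List A → List A → Set where
    done : Reads [] st [] st
    push : ¬ Blocked x st → Reads C (x ∷ st) P S → Reads (x ∷ C) st P S
    pop  : Blocked x (y ∷ st) → Reads (x ∷ C) st P S → Reads (x ∷ C) (y ∷ st) (y ∷ P) S

  Run-deterministic : ∀ {o′} → Run i st o → Run i st o′ → o ≡ o′
  Run-deterministic done        done        = refl
  Run-deterministic (flush r)   (flush r′)  = cong (_ ∷_) (Run-deterministic r r′)
  Run-deterministic (push _ r)  (push _ r′) = Run-deterministic r r′
  Run-deterministic (push ¬b _) (pop b _)   = ⊥-elim (¬b b)
  Run-deterministic (pop b _)   (push ¬b _) = ⊥-elim (¬b b)
  Run-deterministic (pop _ r)   (pop _ r′)  = cong (_ ∷_) (Run-deterministic r r′)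

  Run-flush : ∀ st → Run [] st st
  Run-flush []       = done
  Run-flush (y ∷ st) = flush (Run-flush st)

  Run-flush⁻ : Run [] st o → o ≡ st
  Run-flush⁻ done      = refl
  Run-flush⁻ (flush r) = cong (_ ∷_) (Run-flush⁻ r)

  Reads-++-Run : Reads C st P S → Run i S o → Run (C ++ i) st (P ++ o)
  Reads-++-Run done         r = r
  Reads-++-Run (push ¬b rd) r = push ¬b (Reads-++-Run rd r)
  Reads-++-Run (pop b rd)   r = pop b (Reads-++-Run rd r)

  Run-after-Reads : Reads C st P S → Run (C ++ i) st o → ∃ λ o′ → o ≡ P ++ o′ × Run i S o′
  Run-after-Reads done         r           = _ , refl , r
  Run-after-Reads (push _ rd)  (push _ r)  = Run-after-Reads rd r
  Run-after-Reads (push ¬b _)  (pop b _)   = ⊥-elim (¬b b)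
  Run-after-Reads (pop b _)    (push ¬b _) = ⊥-elim (¬b b)
  Run-after-Reads (pop _ rd)   (pop _ r)   with Run-after-Reads rd r
  ... | o′ , refl , r′ = o′ , refl , r′

  Reads-total : ∀ C st → ∃₂ λ P S → Reads C st P S
  Reads-total [] st = [] , st , done
  Reads-total (x ∷ C) st = step st (blocked? x st)
    where
    step : ∀ st → Dec (Blocked x st) → ∃₂ λ P S → Reads (x ∷ C) st P S
    step st (no ¬b) = Product.map₂ (Product.map₂ (push ¬b)) (Reads-total C (x ∷ st))
    step (y ∷ st) (yes b) = Product.map (y ∷_) (Product.map₂ (pop b)) (step st (blocked? x st))

  Run-total : ∀ i st → ∃ (Run i st)
  Run-total i st with Reads-total i st
  ... | P , S , rd =
    P ++ S , subst (λ i′ → Run i′ st (P ++ S)) (++-identityʳ i) (Reads-++-Run rd (Run-flush S))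

  Run-↭ : Run i st o → o ↭ i ++ st
  Run-↭ done      = ↭-refl
  Run-↭ (flush r) = ↭-prep _ (Run-↭ r)
  Run-↭ {x ∷ i} {st} (push _ r) = ↭-trans (Run-↭ r) (shift x i st)
  Run-↭ {x ∷ i} {y ∷ st} (pop _ r) =
    ↭-trans (↭-prep y (Run-↭ r)) (↭-sym (shift y (x ∷ i) st))

  Reads-↭ : Reads C st P S → P ++ S ↭ C ++ st
  Reads-↭ done = ↭-refl
  Reads-↭ {x ∷ C} {st} (push _ rd) = ↭-trans (Reads-↭ rd) (shift x C st)
  Reads-↭ {x ∷ C} {y ∷ st} (pop _ rd) =
    ↭-trans (↭-prep y (Reads-↭ rd)) (↭-sym (shift y (x ∷ C) st))

  Reads-nonempty : Reads (x ∷ C) st P S → ∃ (_∈ S)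
  Reads-nonempty (push _ done)           = _ , here refl
  Reads-nonempty (push _ rd@(push _ _)) = Reads-nonempty rd
  Reads-nonempty (push _ rd@(pop _ _))  = Reads-nonempty rd
  Reads-nonempty (pop _ rd)              = Reads-nonempty rd

  -- Peak-free words

  Blocked⇒peak : Blocked x st → Triple IsPeak (st ʳ++ x ∷ C)
  Blocked⇒peak {C = C} b with Pair⇒⊆ b
  ... | _ , _ , bc⊆st , (x≺c , c≺b) =
    ⊆⇒Triple (Sublist.ʳ++⁺ bc⊆st (refl ∷ minimum C)) (c≺b , ≺-trans x≺c c≺b)

  Reads-peakFree : Reads C st P S → PeakFree (st ʳ++ C) → P ≡ [] × S ≡ C ʳ++ st
  Reads-peakFree done        _  = refl , refl
  Reads-peakFree (push _ rd) pf = Reads-peakFree rd pf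
  Reads-peakFree (pop b _)   pf = ⊥-elim (pf (Blocked⇒peak b))

  peakFree⇒Run-reverse : ∀ {π} → PeakFree π → Run π [] (reverse π)
  peakFree⇒Run-reverse {π} pf with Reads-total π []
  ... | P , S , rd with Reads-peakFree rd pf
  ... | refl , refl =
    subst (λ π′ → Run π′ [] (reverse π)) (++-identityʳ π) (Reads-++-Run rd (Run-flush S))

  PeakFree-reverse : ∀ {w} → PeakFree w → PeakFree (reverse w)
  PeakFree-reverse {w} pf t =
    pf (subst (Triple IsPeak) (reverse-involutive w) (Triple-map Product.swap (Triple-reverse t)))

  PeakFree-++⁻ˡ : ∀ C → PeakFree (C ++ D) → PeakFree C
  PeakFree-++⁻ˡ {D = D} C pf = pf ∘ Triple-resp-⊆ (Sublist.++⁺ʳ D ⊆-refl)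

  PeakFree-max-∷ : ∀ {w} → All (_≺ n) w → PeakFree w → PeakFree (n ∷ w)
  PeakFree-max-∷ w≺n _ (inj₁ p) with Pair⇒∈ p
  ... | _ , _ , b∈w , _ , (n≺b , _) = ≺-asym n≺b (lookup w≺n b∈w)
  PeakFree-max-∷ _ pf (inj₂ t) = pf t

  PeakFree-insert-max : All (_≺ n) (E ++ F) → PeakFree (E ++ F) → E ≡ [] ⊎ F ≡ [] →
                        PeakFree (E ++ n ∷ F)
  PeakFree-insert-max EF≺n pf (inj₁ refl) = PeakFree-max-∷ EF≺n pf
  PeakFree-insert-max {n = n} {E = E} E≺n pf (inj₂ refl) =
    subst PeakFree rev≡
      (PeakFree-reverse (PeakFree-max-∷ revE≺n (PeakFree-reverse (PeakFree-++⁻ˡ E pf))))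
    where
    revE≺n : All (_≺ n) (reverse E)
    revE≺n = tabulate (lookup (Allₚ.++⁻ˡ E E≺n) ∘ Anyₚ.reverse⁻)
    rev≡ : reverse (n ∷ reverse E) ≡ E ++ [ n ]
    rev≡ = trans (unfold-reverse n (reverse E)) (cong (_++ [ n ]) (reverse-involutive E))

  PeakFree⇒¬132 : ∀ {w} → PeakFree w → ¬ Triple Is132 w
  PeakFree⇒¬132 pf t = pf (Triple-map (λ (a≺c , c≺b) → ≺-trans a≺c c≺b , c≺b) t)

  PeakFree⇒¬231 : ∀ {w} → PeakFree w → ¬ Triple Is231 w
  PeakFree⇒¬231 pf t = pf (Triple-map (λ (c≺a , a≺b) → a≺b , ≺-trans c≺a a≺b) t)

  ¬132-¬231⇒PeakFree : ∀ {w} → Unique w → ¬ Triple Is132 w → ¬ Triple Is231 w → PeakFree w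
  ¬132-¬231⇒PeakFree u ¬132 ¬231 t with Triple⇒⊆ t
  ... | a , b , c , abc⊆w , (a≺b , c≺b) with compare a c
  ... | tri< a≺c _ _ = ¬132 (⊆⇒Triple abc⊆w (a≺c , c≺b))
  ... | tri> _ _ c≺a = ¬231 (⊆⇒Triple abc⊆w (c≺a , a≺b))
  ... | tri≈ _ refl _ with Unique-resp-⊇ abc⊆w u
  ...   | (_ ∷ a≢a ∷ []) ∷ _ = a≢a refl

  -- Deleting the largest entry

  ⊀-max : All (_≺ n) T → All (_≺ n) S → y ∈ T ++ n ∷ S → ¬ n ≺ y
  ⊀-max {T = T} T≺n S≺n y∈ n≺y with Anyₚ.++⁻ T y∈
  ... | inj₁ y∈T         = ≺-asym n≺y (lookup T≺n y∈T)
  ... | inj₂ (here refl) = ≺-irrefl refl n≺y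
  ... | inj₂ (there y∈S) = ≺-asym n≺y (lookup S≺n y∈S)

  ¬Blocked-max : All (_≺ n) st → ¬ Blocked n st
  ¬Blocked-max st≺n b with Pair⇒∈ b
  ... | _ , _ , _ , c∈st , (n≺c , _) = ≺-asym n≺c (lookup st≺n c∈st)

  Blocked-drop-max-bottom : All (_≺ n) T → Blocked x (T ++ [ n ]) → Blocked x T
  Blocked-drop-max-bottom {T = T} T≺n b with Pair-++⁻ T b
  ... | inj₁ b′ = b′
  ... | inj₂ (_ , _ , b∈ , here refl , (_ , n≺b)) = ⊥-elim (⊀-max T≺n [] b∈ n≺b)

  Run-max-bottom : All (_≺ n) i → All (_≺ n) T → Run i T o → Run i (T ++ [ n ]) (o ++ [ n ])
  Run-max-bottom _ _ done = flush done
  Run-max-bottom i≺n (_ ∷ T≺n) (flush r) = flush (Run-max-bottom i≺n T≺n r)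
  Run-max-bottom (x≺n ∷ i≺n) T≺n (push ¬b r) =
    push (¬b ∘ Blocked-drop-max-bottom T≺n) (Run-max-bottom i≺n (x≺n ∷ T≺n) r)
  Run-max-bottom {n = n} i≺n (_ ∷ T≺n) (pop b r) =
    pop (Pair-resp-⊆ (Sublist.++⁺ʳ [ n ] ⊆-refl) b) (Run-max-bottom i≺n T≺n r)

  Blocked-by-max : Any (x ≺_) S → All (_≺ n) S → Blocked x (T ++ n ∷ S)
  Blocked-by-max {T = T} low S≺n with find low
  ... | s , s∈S , x≺s =
    Pair-resp-⊆ (Sublist.++⁺ˡ T ⊆-refl) (inj₁ (lose s∈S (x≺s , lookup S≺n s∈S)))

  below-all : x ∉ S → ¬ Any (x ≺_) S → All (_≺ x) S
  below-all {x = x} {S = S} x∉S ¬low = tabulate below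
    where
    below : ∀ {s} → s ∈ S → s ≺ x
    below {s} s∈S with compare s x
    ... | tri< s≺x _ _ = s≺x
    ... | tri≈ _ refl _ = ⊥-elim (x∉S s∈S)
    ... | tri> _ _ x≺s = ⊥-elim (¬low (lose s∈S x≺s))

  Blocked-drop-max : x ∉ S → All (_≺ n) (t ∷ T) → All (_≺ n) S → All (_≺ t) S →
                     Blocked x (t ∷ T ++ n ∷ S) → Blocked x (t ∷ T ++ S)
  Blocked-drop-max {x = x} {S = S} {t = t} {T = T} x∉S tT≺n S≺n S≺t b with any? (x ≺?_) S
  ... | yes low =
    let s , s∈S , x≺s = find low in inj₁ (Anyₚ.++⁺ʳ T (lose s∈S (x≺s , lookup S≺t s∈S)))
  ... | no ¬low with Pair-++⁻ (t ∷ T) b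
  ...   | inj₁ b′ = Pair-resp-⊆ (Sublist.++⁺ʳ S ⊆-refl) b′
  ...   | inj₂ (_ , _ , b∈ , here refl , (_ , n≺b)) = ⊥-elim (⊀-max tT≺n S≺n b∈ n≺b)
  ...   | inj₂ (_ , _ , _ , there c∈S , (x≺c , _)) =
    ⊥-elim (≺-asym x≺c (lookup (below-all x∉S ¬low) c∈S))

  Reads-final⊆input : Reads C [] P S → ∀ {s} → s ∈ S → s ∈ C
  Reads-final⊆input {C = C} {P = P} rd s∈S
    with Anyₚ.++⁻ C (∈-resp-↭ (Reads-↭ rd) (Anyₚ.++⁺ʳ P s∈S))
  ... | inj₁ s∈C = s∈C

  Reads-initial⊆final : Reads C st [] S → ∀ {s} → s ∈ st → s ∈ S
  Reads-initial⊆final {C = C} rd s∈st = ∈-resp-↭ (↭-sym (Reads-↭ rd)) (Anyₚ.++⁺ʳ C s∈st)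

  popped-above : ¬ Triple Is132 (y ∷ st) → Blocked x (y ∷ st) → (∀ {c} → c ∈ st → c ∈ S) →
                 Any (_≼ y) S
  popped-above _ (inj₁ q) st⊆S with find q
  ... | _ , c∈st , (_ , c≺y) = lose (st⊆S c∈st) (inj₁ c≺y)
  popped-above {y = y} avoids (inj₂ p) st⊆S with Pair⇒⊆ p
  ... | _ , c , bc⊆st , (_ , c≺b) with compare c y
  ...   | tri< c≺y _ _ = lose (st⊆S (Sublist.Any-resp-⊆ bc⊆st (there (here refl)))) (inj₁ c≺y)
  ...   | tri≈ _ c≡y _ = lose (st⊆S (Sublist.Any-resp-⊆ bc⊆st (there (here refl)))) (inj₂ c≡y)
  ...   | tri> _ _ y≺c = ⊥-elim (avoids (inj₁ (⊆⇒Pair bc⊆st (y≺c , c≺b))))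

  Reads-popped-above : ¬ Triple Is132 st → Reads C st P S → P ≡ [] ⊎ Any (λ p → Any (_≼ p) S) P
  Reads-popped-above _ done = inj₁ refl
  Reads-popped-above avoids (push ¬b rd) =
    Reads-popped-above (λ { (inj₁ b) → ¬b b ; (inj₂ t) → avoids t }) rd
  Reads-popped-above avoids (pop b rd) with Reads-popped-above (avoids ∘ inj₂) rd
  ... | inj₂ later = inj₂ (there later)
  ... | inj₁ refl = inj₂ (here (popped-above avoids b (Reads-initial⊆final rd)))

  HeadBelow : List A → List A → Set
  HeadBelow []      S = ⊤
  HeadBelow (x ∷ _) S = Any (x ≺_) S

  data Interleaved : List A → List A → Set where
    left-empty  : Interleaved [] F
    right-empty : Interleaved E []
    dip         : Any (λ e → Any (_≼ e) F) E → Interleaved E F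

  Interleaved-++ : P ≡ [] ⊎ Any (λ p → Any (_≼ p) S) P → All (_∈ F) S →
                   Interleaved E F → Interleaved (P ++ E) F
  Interleaved-++ {P = P} _ _ (dip d) = dip (Anyₚ.++⁺ʳ P d)
  Interleaved-++ _ _ right-empty = right-empty
  Interleaved-++ (inj₁ refl) _ left-empty = left-empty
  Interleaved-++ {S = S} {F = F} (inj₂ above) S⊆F left-empty = dip (Anyₚ.++⁺ˡ (Any.map widen above))
    where
    widen : ∀ {p} → Any (_≼ p) S → Any (_≼ p) F
    widen a with find a
    ... | s , s∈S , s≼p = lose (lookup S⊆F s∈S) s≼p

  record WithoutMax (n : A) (D T S o : List A) : Set where
    field
      before after   : List A
      splits         : o ≡ before ++ n ∷ after
      run            : Run D (T ++ S) (before ++ after)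
      S⊆after        : All (_∈ after) S
      interleaves    : Interleaved before after
      headBelow⇒before≡[] : T ≡ [] → HeadBelow D S → before ≡ []

  -- The entries above n are popped as if n were absent, and n itself goes as soon as an input
  -- entry lies below some entry of S.
  Run-without-max : ∃ (_∈ S) → All (_≺ n) D → All (_≺ n) T → All (_≺ n) S →
                    All (λ t → All (_≺ t) S) T → All (_∉ S) D →
                    Run D (T ++ n ∷ S) o → WithoutMax n D T S o
  Run-without-max {S = S} {D = []} {T = T} (s , s∈S) _ _ _ T≻S _ r with refl ← Run-flush⁻ r = record
    { before = T ; after = S ; splits = refl ; run = Run-flush (T ++ S) ; S⊆after = tabulate id
    ; interleaves = flushed T≻S ; headBelow⇒before≡[] = λ T≡[] _ → T≡[] }
    where
    flushed : ∀ {T} → All (λ t → All (_≺ t) S) T → Interleaved T S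
    flushed []          = left-empty
    flushed (S≺t ∷ _) = dip (here (lose s∈S (inj₁ (lookup S≺t s∈S))))
  Run-without-max {S = S} {D = x ∷ D} {T = []} _ _ _ _ _ _ (pop _ r) = record
    { before = [] ; after = _ ; splits = refl ; run = r
    ; S⊆after = tabulate λ s∈S → ∈-resp-↭ (↭-sym (Run-↭ r)) (Anyₚ.++⁺ʳ (x ∷ D) s∈S)
    ; interleaves = left-empty ; headBelow⇒before≡[] = λ _ _ → refl }
  Run-without-max {S = S} {D = x ∷ D} {T = t ∷ T} ne@(s , s∈S) D≺n (t≺n ∷ T≺n) S≺n (S≺t ∷ T≻S)
                  D∉S@(x∉S ∷ _) (pop b r) = record
    { before = t ∷ W.before ; after = W.after ; splits = cong (t ∷_) W.splits
    ; run = pop (Blocked-drop-max x∉S (t≺n ∷ T≺n) S≺n S≺t b) W.run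
    ; S⊆after = W.S⊆after
    ; interleaves = dip (here (lose (lookup W.S⊆after s∈S) (inj₁ (lookup S≺t s∈S))))
    ; headBelow⇒before≡[] = λ () }
    where module W = WithoutMax (Run-without-max ne D≺n T≺n S≺n T≻S D∉S r)
  Run-without-max {S = S} {n = n} {D = x ∷ D} {T = T} ne (x≺n ∷ D≺n) T≺n S≺n T≻S (x∉S ∷ D∉S)
                  (push ¬b r) = record
    { before = W.before ; after = W.after ; splits = W.splits
    ; run = push (¬b ∘ Pair-resp-⊆ (Sublist.++⁺ ⊆-refl (n ∷ʳ ⊆-refl))) W.run
    ; S⊆after = W.S⊆after ; interleaves = W.interleaves
    ; headBelow⇒before≡[] = λ _ low → ⊥-elim (¬low low) }
    where
    ¬low : ¬ Any (x ≺_) S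
    ¬low low = ¬b (Blocked-by-max low S≺n)
    module W = WithoutMax
      (Run-without-max ne D≺n (x≺n ∷ T≺n) S≺n (below-all x∉S ¬low ∷ T≻S) D∉S r)

  HeadBelow-reverse : ∀ D → HeadBelow D C → HeadBelow D (reverse C)
  HeadBelow-reverse []      _     = tt
  HeadBelow-reverse (_ ∷ _) below = Anyₚ.reverse⁺ below

  record SortWithoutMax (n : A) (C D o : List A) : Set where
    field
      before after        : List A
      splits              : o ≡ before ++ n ∷ after
      run                 : Run (C ++ D) [] (before ++ after)
      interleaves         : Interleaved before after
      C≡[]⇒after≡[]       : C ≡ [] → after ≡ []
      headBelow⇒before≡[] : PeakFree C → HeadBelow D C → before ≡ []

  Run-sort-without-max : All (_≺ n) C → All (_≺ n) D → All (_∉ C) D →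
                         Run (C ++ n ∷ D) [] o → SortWithoutMax n C D o
  Run-sort-without-max {C = []} {D = D} _ D≺n _ (push _ r) with Run-total D []
  ... | o′ , r′ = record
    { before = o′ ; after = [] ; splits = Run-deterministic r (Run-max-bottom D≺n [] r′)
    ; run = subst (Run D []) (sym (++-identityʳ o′)) r′
    ; interleaves = right-empty ; C≡[]⇒after≡[] = λ _ → refl
    ; headBelow⇒before≡[] = nothing-popped D r′ }
    where
    nothing-popped : ∀ D → Run D [] o′ → PeakFree [] → HeadBelow D [] → o′ ≡ []
    nothing-popped []      r _ _  = Run-flush⁻ r
    nothing-popped (_ ∷ _) _ _ ()
  Run-sort-without-max {n = n} {C = C@(_ ∷ _)} {D = D} {o = o} C≺n D≺n D∉C r with Reads-total C []
  ... | P , S , rd = after-reading (Run-after-Reads rd r)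
    where
    S≺n : All (_≺ n) S
    S≺n = tabulate λ s∈S → lookup C≺n (Reads-final⊆input rd s∈S)
    after-reading : (∃ λ o′ → o ≡ P ++ o′ × Run (n ∷ D) S o′) → SortWithoutMax n C D o
    after-reading (_ , _ , pop b _) = ⊥-elim (¬Blocked-max S≺n b)
    after-reading (_ , o≡ , push _ r′) = record
      { before = P ++ W.before ; after = W.after
      ; splits = trans o≡ (trans (cong (P ++_) W.splits) (sym (++-assoc P W.before (n ∷ W.after))))
      ; run = subst (Run (C ++ D) []) (sym (++-assoc P W.before W.after)) (Reads-++-Run rd W.run)
      ; interleaves = Interleaved-++ (Reads-popped-above (λ ()) rd) W.S⊆after W.interleaves
      ; C≡[]⇒after≡[] = λ ()
      ; headBelow⇒before≡[] = nothing-popped }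
      where
      module W = WithoutMax (Run-without-max {T = []} (Reads-nonempty rd) D≺n [] S≺n []
                   (All.map (λ x∉C x∈S → x∉C (Reads-final⊆input rd x∈S)) D∉C) r′)
      nothing-popped : PeakFree C → HeadBelow D C → P ++ W.before ≡ []
      nothing-popped pf below with Reads-peakFree rd pf
      ... | P≡[] , S≡ =
        trans (cong (_++ W.before) P≡[])
              (W.headBelow⇒before≡[] refl (subst (HeadBelow D) (sym S≡) (HeadBelow-reverse D below)))

  dip⇒HeadBelow : PeakFree (C ++ D) → All (_∉ C) D → Any (λ c → Any (_≼ c) D) C → HeadBelow D C
  dip⇒HeadBelow {D = []} _ _ _ = tt
  dip⇒HeadBelow {D = h ∷ D} pf D∉C d with find d
  ... | c , c∈C , d≼c with find d≼c
  ... | _ , d∈ , inj₂ refl = ⊥-elim (lookup D∉C d∈ c∈C)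
  ... | _ , here refl , inj₁ h≺c = lose c∈C h≺c
  ... | _ , there d∈D , inj₁ d≺c with compare h c
  ...   | tri< h≺c _ _ = lose c∈C h≺c
  ...   | tri≈ _ refl _ = ⊥-elim (lookup D∉C (here refl) c∈C)
  ...   | tri> _ _ c≺h =
    ⊥-elim (pf (⊆⇒Triple (Sublist.++⁺ (from∈ c∈C) (refl ∷ from∈ d∈D))
                         (c≺h , ≺-trans d≺c c≺h)))

  -- When C D is peak-free, C is read without popping, and an entry of D below an entry of C
  -- makes the head of D lie below one too (else C and D contain a peak): then n is popped at once.
  max-at-an-end : Interleaved C D → PeakFree (C ++ D) → All (_∉ C) D → (W : SortWithoutMax n C D o) →
                  SortWithoutMax.before W ≡ [] ⊎ SortWithoutMax.after W ≡ []
  max-at-an-end left-empty _ _ W = inj₂ (SortWithoutMax.C≡[]⇒after≡[] W refl)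
  max-at-an-end {C = C} right-empty pf _ W =
    inj₁ (SortWithoutMax.headBelow⇒before≡[] W (PeakFree-++⁻ˡ C pf) tt)
  max-at-an-end {C = C} (dip d) pf D∉C W =
    inj₁ (SortWithoutMax.headBelow⇒before≡[] W (PeakFree-++⁻ˡ C pf) (dip⇒HeadBelow pf D∉C d))

  Run-sort-peakFree : Interleaved C D → PeakFree (C ++ D) → All (_≺ n) (C ++ D) → All (_∉ C) D →
                      Run (C ++ n ∷ D) [] o → PeakFree o
  Run-sort-peakFree {C = C} {D = D} {n = n} {o = o} il pf CD≺n D∉C r =
    subst PeakFree (sym W.splits) (PeakFree-insert-max EF≺n EF-peakFree (max-at-an-end il pf D∉C W))
    where
    W : SortWithoutMax n C D o
    W = Run-sort-without-max (Allₚ.++⁻ˡ C CD≺n) (Allₚ.++⁻ʳ C CD≺n) D∉C r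
    module W = SortWithoutMax W
    EF-peakFree : PeakFree (W.before ++ W.after)
    EF-peakFree = subst PeakFree (Run-deterministic (peakFree⇒Run-reverse pf) W.run) (PeakFree-reverse pf)
    EF≺n : All (_≺ n) (W.before ++ W.after)
    EF≺n = All-resp-↭ (↭-sym (Run-↭ W.run)) (Allₚ.++⁺ CD≺n [])

  split-at-max : ∀ x w → Unique (x ∷ w) →
                 ∃₂ λ C n → ∃ λ D → x ∷ w ≡ C ++ n ∷ D × All (_≺ n) (C ++ D)
  split-at-max x []      _          = [] , x , [] , refl , []
  split-at-max x (y ∷ w) (x∉ ∷ u) with split-at-max y w u
  ... | C , n , D , eq , CD≺n with compare x n
  ... | tri< x≺n _ _ = x ∷ C , n , D , cong (x ∷_) eq , x≺n ∷ CD≺n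
  ... | tri≈ _ refl _ = ⊥-elim (lookup x∉ (subst (x ∈_) (sym eq) (Anyₚ.++⁺ʳ C (here refl))) refl)
  ... | tri> _ _ n≺x =
    [] , x , y ∷ w , refl ,
    subst (All (_≺ x)) (sym eq) (Allₚ.++⁺ (Allₚ.++⁻ˡ C CD≺x) (n≺x ∷ Allₚ.++⁻ʳ C CD≺x))
    where
    CD≺x : All (_≺ x) (C ++ D)
    CD≺x = All.map (λ z≺n → ≺-trans z≺n n≺x) CD≺n

-- Iterating the stack map

iter-suc : ∀ (f : List ℕ → List ℕ) t π → iter f t (f π) ≡ iter f (suc t) π
iter-suc f zero    π = refl
iter-suc f (suc t) π = cong f (iter-suc f t π)

iter-returns : ∀ (f : List ℕ → List ℕ) {π} t → iter f (suc t) π ≡ π →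
               ∀ j → ∃ λ d → iter f d (iter f j π) ≡ π
iter-returns f t period zero = zero , refl
iter-returns f {π} t period (suc j) with iter-returns f t period j
... | zero  , back = t , trans (cong (iter f t ∘ f) back) (trans (iter-suc f t π) period)
... | suc d , back = d , trans (iter-suc f d (iter f j π)) back

module Dynamics {_≺_ : ℕ → ℕ → Set} (≺-isStrictTotalOrder : IsStrictTotalOrder _≡_ _≺_)
                (s : List ℕ → List ℕ)
                (s-run : ∀ π → StackSorting.Run ≺-isStrictTotalOrder π [] (s π)) where

  open StackSorting ≺-isStrictTotalOrder

  private variable
    n : ℕ
    π π′ : List ℕ

  s-↭ : ∀ π → s π ↭ π
  s-↭ π = subst (s π ↭_) (++-identityʳ π) (Run-↭ (s-run π))

  iter-↭ : ∀ t π → iter s t π ↭ π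
  iter-↭ zero    π = ↭-refl
  iter-↭ (suc t) π = ↭-trans (s-↭ (iter s t π)) (iter-↭ t π)

  s-reverse : PeakFree π → s π ≡ reverse π
  s-reverse pf = Run-deterministic (s-run _) (peakFree⇒Run-reverse pf)

  iter-peakFree : ∀ t → PeakFree π → PeakFree (iter s t π)
  iter-peakFree zero    pf = pf
  iter-peakFree (suc t) pf =
    subst PeakFree (sym (s-reverse (iter-peakFree t pf))) (PeakFree-reverse (iter-peakFree t pf))

  peakFree⇒period-2 : PeakFree π → iter s 2 π ≡ π
  peakFree⇒period-2 {π} pf = begin
    s (s π)             ≡⟨ cong s (s-reverse pf) ⟩
    s (reverse π)       ≡⟨ s-reverse (PeakFree-reverse pf) ⟩
    reverse (reverse π) ≡⟨ reverse-involutive π ⟩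
    π                   ∎
    where open ≡-Reasoning

  short-peakFree : ∀ t → length π ≤ 2 → PeakFree (iter s t π)
  short-peakFree {π} t len≤2 triple
    with ≤-trans (Triple-length triple) (≤-trans (≤-reflexive (↭-length (iter-↭ t π))) len≤2)
  ... | s≤s (s≤s ())

  record MaxTracked (n : ℕ) (π π′ : List ℕ) : Set where
    field
      C D         : List ℕ
      with-max    : π ≡ C ++ n ∷ D
      without-max : π′ ≡ C ++ D
      below-max   : All (_≺ n) (C ++ D)
      unique      : Unique (C ++ n ∷ D)

    D∉C : All (_∉ C) D
    D∉C = All.tail (Unique-++⇒∉ C unique)

    run : Run (C ++ n ∷ D) [] (s π)
    run = subst (λ w → Run w [] (s π)) with-max (s-run π)

  s-tracked : MaxTracked n π π′ →
              Σ (MaxTracked n (s π) (s π′)) λ M → Interleaved (MaxTracked.C M) (MaxTracked.D M)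
  s-tracked {n = n} {π = π} {π′ = π′} M = record
    { C = W.before ; D = W.after ; with-max = W.splits ; without-max = without-max′
    ; below-max = All-resp-↭ (↭-sym (subst₂ _↭_ without-max′ without-max (s-↭ π′))) below-max
    ; unique = Unique-resp-↭ (↭-sym (subst₂ _↭_ W.splits with-max (s-↭ π))) unique } , W.interleaves
    where
    open MaxTracked M
    W : SortWithoutMax n C D (s π)
    W = Run-sort-without-max (Allₚ.++⁻ˡ C below-max) (Allₚ.++⁻ʳ C below-max) D∉C run
    module W = SortWithoutMax W
    without-max′ : s π′ ≡ W.before ++ W.after
    without-max′ = Run-deterministic (subst (λ w → Run w [] (s π′)) without-max (s-run π′)) W.run

  iter-tracked : ∀ t → MaxTracked n π π′ → MaxTracked n (iter s t π) (iter s t π′)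
  iter-tracked zero    M = M
  iter-tracked (suc t) M = proj₁ (s-tracked (iter-tracked t M))

  tracked-peakFree : MaxTracked n π π′ → PeakFree (s π′) → PeakFree (s (s π))
  tracked-peakFree M pf with s-tracked M
  ... | M′ , interleaves =
    Run-sort-peakFree interleaves (subst PeakFree without-max pf) below-max D∉C run
    where open MaxTracked M′

  remove-max : ∀ x w → Unique (x ∷ w) →
               ∃₂ λ n π′ → MaxTracked n (x ∷ w) π′ × Unique π′ × suc (length π′) ≡ length (x ∷ w)
  remove-max x w u with split-at-max x w u
  ... | C , n , D , split , CD≺n =
    n , C ++ D , tracked , Unique-remove C u′ ,
    trans (sym (↭-length (shift n C D))) (cong length (sym split))
    where
    u′ : Unique (C ++ n ∷ D)
    u′ = subst Unique split u
    tracked : MaxTracked n (x ∷ w) (C ++ D)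
    tracked = record
      { C = C ; D = D ; with-max = split ; without-max = refl ; below-max = CD≺n ; unique = u′ }

  peakFree-after : ∀ m {π} → Unique π → length π ≡ m → PeakFree (iter s (m ∸ 1) π)
  peakFree-after 0 _ len = short-peakFree 0 (≤-trans (≤-reflexive len) z≤n)
  peakFree-after 1 _ len = short-peakFree 0 (≤-trans (≤-reflexive len) (s≤s z≤n))
  peakFree-after 2 _ len = short-peakFree 1 (≤-reflexive len)
  peakFree-after (suc (suc (suc k))) {x ∷ w} u len =
    let _ , _ , M , u′ , len′ = remove-max x w u
    in tracked-peakFree (iter-tracked k M)
                        (peakFree-after (suc (suc k)) u′ (suc-injective (trans len′ len)))

  periodic⇒peakFree : Unique π → IsPeriodic s π → PeakFree π
  periodic⇒peakFree {π} u (suc t , _ , period) with iter-returns s t period (length π ∸ 1)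
  ... | d , back = subst PeakFree back (iter-peakFree d (peakFree-after (length π) u refl))

-- Patterns of length three

indicator : ∀ {P : Set} → Dec P → ℕ
indicator (yes _) = 1
indicator (no _)  = 0

indicator-yes : ∀ {x y} → x < y → indicator (x <? y) ≡ 1
indicator-yes {x} {y} x<y with x <? y
... | yes _   = refl
... | no x≮y = ⊥-elim (x≮y x<y)

indicator-no : ∀ {x y} → ¬ x < y → indicator (x <? y) ≡ 0
indicator-no {x} {y} x≮y with x <? y
... | yes x<y = ⊥-elim (x≮y x<y)
... | no _    = refl

indicator-self : ∀ x → indicator (x <? x) ≡ 0
indicator-self x = indicator-no (<-irrefl refl)

exactly-two : ∀ {A B C : Set} (p : Dec A) (q : Dec B) (r : Dec C) →
              indicator p + (indicator q + (indicator r + 0)) ≡ 2 → (A × B) ⊎ (A × C) ⊎ (B × C)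
exactly-two (yes a) (yes b) (no _)  _ = inj₁ (a , b)
exactly-two (yes a) (no _)  (yes c) _ = inj₂ (inj₁ (a , c))
exactly-two (no _)  (yes b) (yes c) _ = inj₂ (inj₂ (b , c))
exactly-two (yes _) (yes _) (yes _) ()
exactly-two (yes _) (no _)  (no _)  ()
exactly-two (no _)  (yes _) (no _)  ()
exactly-two (no _)  (no _)  (yes _) ()
exactly-two (no _)  (no _)  (no _)  ()

exactly-one : ∀ {A B C : Set} (p : Dec A) (q : Dec B) (r : Dec C) →
              indicator p + (indicator q + (indicator r + 0)) ≡ 1 → A ⊎ B ⊎ C
exactly-one (yes a) (no _)  (no _)  _ = inj₁ a
exactly-one (no _)  (yes b) (no _)  _ = inj₂ (inj₁ b)
exactly-one (no _)  (no _)  (yes c) _ = inj₂ (inj₂ c)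
exactly-one (yes _) (yes _) (yes _) ()
exactly-one (yes _) (yes _) (no _)  ()
exactly-one (yes _) (no _)  (yes _) ()
exactly-one (no _)  (yes _) (yes _) ()
exactly-one (no _)  (no _)  (no _)  ()

rank-∷ : ∀ x xs y → rank (x ∷ xs) y ≡ indicator (x <? y) + rank xs y
rank-∷ x xs y with x <? y
... | yes x<y rewrite filter-accept (_<? y) {xs = xs} x<y = refl
... | no x≮y rewrite filter-reject (_<? y) {xs = xs} x≮y = refl

rank₃ : ℕ → ℕ → ℕ → ℕ → ℕ
rank₃ a b c v = indicator (a <? v) + (indicator (b <? v) + (indicator (c <? v) + 0))

std₃ : ∀ a b c → std (a ∷ b ∷ c ∷ []) ≡ rank₃ a b c a ∷ rank₃ a b c b ∷ rank₃ a b c c ∷ []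
std₃ a b c rewrite rank-∷ a (b ∷ c ∷ []) a | rank-∷ b (c ∷ []) a | rank-∷ c [] a
                 | rank-∷ a (b ∷ c ∷ []) b | rank-∷ b (c ∷ []) b | rank-∷ c [] b
                 | rank-∷ a (b ∷ c ∷ []) c | rank-∷ b (c ∷ []) c | rank-∷ c [] c = refl

module _ {a b c : ℕ} where

  private
    irrefl : ∀ {x} → ¬ x < x
    irrefl = <-irrefl refl

  ranks : ∀ {x y z} → std (a ∷ b ∷ c ∷ []) ≡ x ∷ y ∷ z ∷ [] →
          rank₃ a b c a ≡ x × rank₃ a b c b ≡ y × rank₃ a b c c ≡ z
  ranks same with ∷-injective (trans (sym (std₃ a b c)) same)
  ... | ra , rest with ∷-injective rest
  ... | rb , rest′ with ∷-injective rest′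
  ... | rc , _ = ra , rb , rc

  rank₁≡2 : rank₃ a b c a ≡ 2 → b < a × c < a
  rank₁≡2 r with exactly-two (a <? a) (b <? a) (c <? a) r
  ... | inj₁ (a<a , _)        = ⊥-elim (irrefl a<a)
  ... | inj₂ (inj₁ (a<a , _)) = ⊥-elim (irrefl a<a)
  ... | inj₂ (inj₂ below)     = below

  rank₂≡2 : rank₃ a b c b ≡ 2 → a < b × c < b
  rank₂≡2 r with exactly-two (a <? b) (b <? b) (c <? b) r
  ... | inj₁ (_ , b<b)        = ⊥-elim (irrefl b<b)
  ... | inj₂ (inj₁ below)     = below
  ... | inj₂ (inj₂ (b<b , _)) = ⊥-elim (irrefl b<b)

  rank₃≡2 : rank₃ a b c c ≡ 2 → a < c × b < c
  rank₃≡2 r with exactly-two (a <? c) (b <? c) (c <? c) r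
  ... | inj₁ below            = below
  ... | inj₂ (inj₁ (_ , c<c)) = ⊥-elim (irrefl c<c)
  ... | inj₂ (inj₂ (_ , c<c)) = ⊥-elim (irrefl c<c)

  rank₁≡1 : rank₃ a b c a ≡ 1 → b < a ⊎ c < a
  rank₁≡1 r with exactly-one (a <? a) (b <? a) (c <? a) r
  ... | inj₁ a<a = ⊥-elim (irrefl a<a)
  ... | inj₂ below = below

  rank₃≡1 : rank₃ a b c c ≡ 1 → a < c ⊎ b < c
  rank₃≡1 r with exactly-one (a <? c) (b <? c) (c <? c) r
  ... | inj₁ a<c = inj₁ a<c
  ... | inj₂ (inj₁ b<c) = inj₂ b<c
  ... | inj₂ (inj₂ c<c) = ⊥-elim (irrefl c<c)

  order-132 : SameOrder (a ∷ b ∷ c ∷ []) (1 ∷ 3 ∷ 2 ∷ []) ⇔ (a < c × c < b)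
  order-132 = mk⇔ to from
    where
    to : SameOrder (a ∷ b ∷ c ∷ []) (1 ∷ 3 ∷ 2 ∷ []) → a < c × c < b
    to same with ranks same
    ... | _ , r₂ , r₃ with rank₂≡2 r₂ | rank₃≡1 r₃
    ... | _ , c<b | inj₁ a<c = a<c , c<b
    ... | _ , c<b | inj₂ b<c = ⊥-elim (<-asym b<c c<b)
    from : a < c × c < b → SameOrder (a ∷ b ∷ c ∷ []) (1 ∷ 3 ∷ 2 ∷ [])
    from (a<c , c<b) rewrite std₃ a b c | indicator-self a | indicator-self b | indicator-self c
      | indicator-no {b} {a} (<-asym (<-trans a<c c<b)) | indicator-no {c} {a} (<-asym a<c)
      | indicator-yes (<-trans a<c c<b) | indicator-yes c<b | indicator-yes a<c
      | indicator-no {b} {c} (<-asym c<b) = refl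

  order-231 : SameOrder (a ∷ b ∷ c ∷ []) (2 ∷ 3 ∷ 1 ∷ []) ⇔ (c < a × a < b)
  order-231 = mk⇔ to from
    where
    to : SameOrder (a ∷ b ∷ c ∷ []) (2 ∷ 3 ∷ 1 ∷ []) → c < a × a < b
    to same with ranks same
    ... | r₁ , r₂ , _ with rank₂≡2 r₂ | rank₁≡1 r₁
    ... | a<b , _ | inj₁ b<a = ⊥-elim (<-asym a<b b<a)
    ... | a<b , _ | inj₂ c<a = c<a , a<b
    from : c < a × a < b → SameOrder (a ∷ b ∷ c ∷ []) (2 ∷ 3 ∷ 1 ∷ [])
    from (c<a , a<b) rewrite std₃ a b c | indicator-self a | indicator-self b | indicator-self c
      | indicator-no {b} {a} (<-asym a<b) | indicator-yes c<a | indicator-yes a<b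
      | indicator-yes (<-trans c<a a<b) | indicator-no {a} {c} (<-asym c<a)
      | indicator-no {b} {c} (<-asym (<-trans c<a a<b)) = refl

  order-312 : SameOrder (a ∷ b ∷ c ∷ []) (3 ∷ 1 ∷ 2 ∷ []) ⇔ (c < a × b < c)
  order-312 = mk⇔ to from
    where
    to : SameOrder (a ∷ b ∷ c ∷ []) (3 ∷ 1 ∷ 2 ∷ []) → c < a × b < c
    to same with ranks same
    ... | r₁ , _ , r₃ with rank₁≡2 r₁ | rank₃≡1 r₃
    ... | _ , c<a | inj₁ a<c = ⊥-elim (<-asym a<c c<a)
    ... | _ , c<a | inj₂ b<c = c<a , b<c
    from : c < a × b < c → SameOrder (a ∷ b ∷ c ∷ []) (3 ∷ 1 ∷ 2 ∷ [])
    from (c<a , b<c) rewrite std₃ a b c | indicator-self a | indicator-self b | indicator-self c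
      | indicator-yes (<-trans b<c c<a) | indicator-yes c<a | indicator-no {a} {b} (<-asym (<-trans b<c c<a))
      | indicator-no {c} {b} (<-asym b<c) | indicator-no {a} {c} (<-asym c<a) | indicator-yes b<c = refl

  order-213 : SameOrder (a ∷ b ∷ c ∷ []) (2 ∷ 1 ∷ 3 ∷ []) ⇔ (a < c × b < a)
  order-213 = mk⇔ to from
    where
    to : SameOrder (a ∷ b ∷ c ∷ []) (2 ∷ 1 ∷ 3 ∷ []) → a < c × b < a
    to same with ranks same
    ... | r₁ , _ , r₃ with rank₃≡2 r₃ | rank₁≡1 r₁
    ... | a<c , _ | inj₁ b<a = a<c , b<a
    ... | a<c , _ | inj₂ c<a = ⊥-elim (<-asym a<c c<a)
    from : a < c × b < a → SameOrder (a ∷ b ∷ c ∷ []) (2 ∷ 1 ∷ 3 ∷ [])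
    from (a<c , b<a) rewrite std₃ a b c | indicator-self a | indicator-self b | indicator-self c
      | indicator-yes b<a | indicator-no {c} {a} (<-asym a<c) | indicator-no {a} {b} (<-asym b<a)
      | indicator-no {c} {b} (<-asym (<-trans b<a a<c)) | indicator-yes a<c
      | indicator-yes (<-trans b<a a<c) = refl

SameOrder-length : ∀ xs ys → SameOrder xs ys → length xs ≡ length ys
SameOrder-length xs ys same =
  trans (sym (length-map (rank xs) xs)) (trans (cong length same) (length-map (rank ys) ys))

Contains₃⇔Triple : ∀ x y z {P : ℕ → ℕ → ℕ → Set} →
                   (∀ {a b c} → SameOrder (a ∷ b ∷ c ∷ []) (x ∷ y ∷ z ∷ []) ⇔ P a b c) →
                   ∀ w → Contains (x ∷ y ∷ z ∷ []) w ⇔ Triple P w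
Contains₃⇔Triple x y z {P} order w = mk⇔ to from
  where
  to : Contains (x ∷ y ∷ z ∷ []) w → Triple P w
  to (_ ∷ _ ∷ _ ∷ [] , abc⊆w , same) = ⊆⇒Triple abc⊆w (Equivalence.to order same)
  to (ys@[] , _ , same)                with () ← SameOrder-length ys (x ∷ y ∷ z ∷ []) same
  to (ys@(_ ∷ []) , _ , same)          with () ← SameOrder-length ys (x ∷ y ∷ z ∷ []) same
  to (ys@(_ ∷ _ ∷ []) , _ , same)      with () ← SameOrder-length ys (x ∷ y ∷ z ∷ []) same
  to (ys@(_ ∷ _ ∷ _ ∷ _ ∷ _) , _ , same) with () ← SameOrder-length ys (x ∷ y ∷ z ∷ []) same
  from : Triple P w → Contains (x ∷ y ∷ z ∷ []) w
  from t with Triple⇒⊆ t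
  ... | a , b , c , abc⊆w , p = a ∷ b ∷ c ∷ [] , abc⊆w , Equivalence.from order p

-- The stack maps s₁₃₂ and s₃₁₂

IsPerm⇒Unique : ∀ {n π} → IsPerm n π → Unique π
IsPerm⇒Unique {n} p = Unique-resp-↭ (↭-sym p) (Uniqueₚ.map⁺ suc-injective (Uniqueₚ.upTo⁺ n))

IsPerm⇒length : ∀ {n π} → IsPerm n π → length π ≡ n
IsPerm⇒length {n} p = trans (↭-length p) (trans (length-map suc (upTo n)) (length-upTo n))

module Machine (σ : List ℕ) {_≺_ : ℕ → ℕ → Set} (≺-isStrictTotalOrder : IsStrictTotalOrder _≡_ _≺_)
               (σ⇔132 : ∀ w → Contains σ w ⇔ Triple (StackSorting.Is132 ≺-isStrictTotalOrder) w) where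

  open StackSorting ≺-isStrictTotalOrder

  go-Run : ∀ {i st o} f → Run i st o → ¬ Triple Is132 st → length i * 2 + length st ≤ f →
           go σ f i st ≡ o
  go-Run zero    done      _      _            = refl
  go-Run (suc f) done      _      _            = refl
  go-Run (suc f) (flush r) avoids (s≤s bound) = cong (_ ∷_) (go-Run f r (avoids ∘ inj₂) bound)
  go-Run {x ∷ i} {st} (suc f) (push ¬b r) avoids (s≤s bound) with contains? σ (x ∷ st)
  ... | yes c with Equivalence.to (σ⇔132 (x ∷ st)) c
  ...   | inj₁ b = ⊥-elim (¬b b)
  ...   | inj₂ t = ⊥-elim (avoids t)
  go-Run {x ∷ i} {st} (suc f) (push ¬b r) avoids (s≤s bound) | no _ =
    go-Run f r (λ { (inj₁ b) → ¬b b ; (inj₂ t) → avoids t })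
           (≤-trans (≤-reflexive (+-suc (length i * 2) (length st))) bound)
  go-Run {x ∷ i} {y ∷ st} (suc f) (pop b r) avoids (s≤s bound) with contains? σ (x ∷ y ∷ st)
  ... | yes _ = cong (y ∷_) (go-Run f r (avoids ∘ inj₂)
                  (≤-trans (≤-reflexive (cong suc (sym (+-suc (length i * 2) (length st))))) bound))
  ... | no ¬c = ⊥-elim (¬c (Equivalence.from (σ⇔132 (x ∷ y ∷ st)) (inj₁ b)))

  stackSort-Run : ∀ π → Run π [] (stackSort σ π)
  stackSort-Run π with Run-total π []
  ... | o , r = subst (Run π []) (sym (go-Run (2 * length π) r (λ ()) bound)) r
    where
    bound : length π * 2 + 0 ≤ 2 * length π
    bound = ≤-reflexive (trans (+-identityʳ _) (*-comm (length π) 2))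

module Periodicity (σ τ : List ℕ) {_≺_ : ℕ → ℕ → Set} (≺-isStrictTotalOrder : IsStrictTotalOrder _≡_ _≺_)
                   (σ⇔132 : ∀ w → Contains σ w ⇔ Triple (StackSorting.Is132 ≺-isStrictTotalOrder) w)
                   (τ⇔231 : ∀ w → Contains τ w ⇔ Triple (StackSorting.Is231 ≺-isStrictTotalOrder) w) where

  open StackSorting ≺-isStrictTotalOrder
  open Dynamics ≺-isStrictTotalOrder (stackSort σ) (Machine.stackSort-Run σ ≺-isStrictTotalOrder σ⇔132)

  peakFree⇒avoids : ∀ {w} → PeakFree w → Avoids σ w × Avoids τ w
  peakFree⇒avoids {w} pf =
    PeakFree⇒¬132 pf ∘ Equivalence.to (σ⇔132 w) , PeakFree⇒¬231 pf ∘ Equivalence.to (τ⇔231 w)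

  avoids⇒peakFree : ∀ {w} → Unique w → Avoids σ w × Avoids τ w → PeakFree w
  avoids⇒peakFree {w} u (¬σ , ¬τ) =
    ¬132-¬231⇒PeakFree u (¬σ ∘ Equivalence.from (σ⇔132 w)) (¬τ ∘ Equivalence.from (τ⇔231 w))

  periodic⇔avoids : ∀ {n π} → IsPerm n π →
                    IsPeriodic (stackSort σ) π ⇔ (Avoids σ π × Avoids τ π)
  periodic⇔avoids p = mk⇔
    (peakFree⇒avoids ∘ periodic⇒peakFree (IsPerm⇒Unique p))
    (λ avoids → 2 , s≤s z≤n , peakFree⇒period-2 (avoids⇒peakFree (IsPerm⇒Unique p) avoids))

  periodic⇒period-2 : ∀ {n π} → 2 ≤ n → IsPerm n π → IsPeriodic (stackSort σ) π →
                      HasPeriod (stackSort σ) π 2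
  periodic⇒period-2 {π = π} 2≤n p periodic = s≤s z≤n , peakFree⇒period-2 pf , not-fixed
    where
    u : Unique π
    u = IsPerm⇒Unique p
    pf : PeakFree π
    pf = periodic⇒peakFree u periodic
    not-fixed : ∀ t → 1 ≤ t → t < 2 → ¬ iter (stackSort σ) t π ≡ π
    not-fixed (suc zero) _ _ fixed =
      reverse-≢ u (subst (2 ≤_) (sym (IsPerm⇒length p)) 2≤n) (trans (sym (s-reverse pf)) fixed)
    not-fixed (suc (suc _)) _ (s≤s (s≤s ()))

  avoids-after : ∀ {n π} → IsPerm n π →
                 Avoids σ (iter (stackSort σ) (n ∸ 1) π) × Avoids τ (iter (stackSort σ) (n ∸ 1) π)
  avoids-after p = peakFree⇒avoids (peakFree-after _ (IsPerm⇒Unique p) (IsPerm⇒length p))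

module S132 = Periodicity (1 ∷ 3 ∷ 2 ∷ []) (2 ∷ 3 ∷ 1 ∷ []) <-isStrictTotalOrder
                          (Contains₃⇔Triple 1 3 2 order-132) (Contains₃⇔Triple 2 3 1 order-231)
module S312 = Periodicity (3 ∷ 1 ∷ 2 ∷ []) (2 ∷ 1 ∷ 3 ∷ []) (Flip.isStrictTotalOrder <-isStrictTotalOrder)
                          (Contains₃⇔Triple 3 1 2 order-312) (Contains₃⇔Triple 2 1 3 order-213)

⇔-swap : ∀ {A B C : Set} → A ⇔ (B × C) → A ⇔ (C × B)
⇔-swap e = mk⇔ (Product.swap ∘ Equivalence.to e) (Equivalence.from e ∘ Product.swap)

theorem7p1 : (n : ℕ) → 1 ≤ n →
      ((π : List ℕ) → IsPerm n π →
        IsPeriodic s132 π ⇔ (Avoids (1 ∷ 3 ∷ 2 ∷ []) π × Avoids (2 ∷ 3 ∷ 1 ∷ []) π))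
    × ((π : List ℕ) → IsPerm n π →
        IsPeriodic s312 π ⇔ (Avoids (2 ∷ 1 ∷ 3 ∷ []) π × Avoids (3 ∷ 1 ∷ 2 ∷ []) π))
    × (2 ≤ n → (π : List ℕ) → IsPerm n π → IsPeriodic s132 π → HasPeriod s132 π 2)
    × (2 ≤ n → (π : List ℕ) → IsPerm n π → IsPeriodic s312 π → HasPeriod s312 π 2)
    × ((π : List ℕ) → IsPerm n π →
        Avoids (1 ∷ 3 ∷ 2 ∷ []) (iter s132 (n ∸ 1) π) × Avoids (2 ∷ 3 ∷ 1 ∷ []) (iter s132 (n ∸ 1) π))
    × ((π : List ℕ) → IsPerm n π →
        Avoids (2 ∷ 1 ∷ 3 ∷ []) (iter s312 (n ∸ 1) π) × Avoids (3 ∷ 1 ∷ 2 ∷ []) (iter s312 (n ∸ 1) π))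
theorem7p1 n _ =
    (λ _ → S132.periodic⇔avoids)
  , (λ _ → ⇔-swap ∘ S312.periodic⇔avoids)
  , (λ 2≤n _ → S132.periodic⇒period-2 2≤n)
  , (λ 2≤n _ → S312.periodic⇒period-2 2≤n)
  , (λ _ → S132.avoids-after)
  , (λ _ → Product.swap ∘ S312.avoids-after)
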